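{- Let $c$ be a proper edge coloring of $K_n=(V,E)$ and let $P=(p_1,\dots,p_k)$ be a maximum rainbow path (a rainbow path with the largest possible number of vertices). Then for every $p_i\in A(P)$ we have $c(p_i,p_{i+1})\notin c(p_k,V(P)^c)$, and for every $p_i\in B(P)$ we have $c(p_i,p_{i-1})\notin c(p_1,V(P)^c)$.
   Context: A proper edge coloring of a graph $G=(V,E)$ is a map $c\colon E\to\mathbb{N}$ such that any two distinct edges sharing an endpoint receive different colors; a path is rainbow if no two of its edges have the same color. For a path $P$, $c(P)$ is the set of colors on its edges, $V(P)^c=V\setminus V(P)$, $c(u,v)$ is the color of the edge $\{u,v\}$, and for a vertex set $S$, $c(v,S)$ is the set of colors of the edges $\{v,s\}$, $s\in S$. For a rainbow path $P$ and vertex $v$, $\Gamma_{\mathrm{new}}(v,P)=\{u\in V\setminus\{v\}: c(u,v)\notin c(P)\}$. For $P=(p_1,\dots,p_k)$, $A(P)=\{p_i: i<k,\ p_{i+1}\in\Gamma_{\mathrm{new}}(p_1,P)\}$ and $B(P)=\{p_i: i>1,\ p_{i-1}\in\Gamma_{\mathrm{new}}(p_k,P)\}$. -}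

module Defs where

open import Data.Nat using (ℕ; zero; suc; _<_; _≤_; s≤s; z≤n)
open import Data.Nat.Properties using (<-trans; n<1+n)
open import Data.Fin using (Fin; fromℕ<)
open import Data.Product using (Σ; _×_; _,_; ∃-syntax)
open import Relation.Binary.PropositionalEquality using (_≡_; _≢_)
open import Relation.Nullary using (¬_)
open import Function.Definitions using (Injective)

-- Vertices of K_n are Fin n; a colouring assigns a colour (ℕ) to each
-- ordered pair; on the complete graph every pair of distinct vertices is an
-- edge, so we require symmetry (c u v is the colour of the edge {u,v}).
record ProperColoring (n : ℕ) : Set where
  field
    col  : Fin n → Fin n → ℕ
    sym  : ∀ u v → col u v ≡ col v u
    prop : ∀ u v w → u ≢ v → u ≢ w → v ≢ w → col u v ≢ col u w
open ProperColoring public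

-- A path with k vertices p_0 … p_{k-1} (0-indexed) is an injective map Fin k → Fin n
-- (consecutive vertices are always adjacent in K_n).
Path : ℕ → ℕ → Set
Path n k = Σ (Fin k → Fin n) (λ p → Injective _≡_ _≡_ p)

at : ∀ {n k} → Path n k → (i : ℕ) → i < k → Fin n
at (p , _) i i<k = p (fromℕ< i<k)

edgeCol : ∀ {n k} → ProperColoring n → Path n k → (j : ℕ) → suc j < k → ℕ
edgeCol c P j lt = col c (at P j (<-trans (n<1+n j) lt)) (at P (suc j) lt)

InColors : ∀ {n k} → ProperColoring n → Path n k → ℕ → Set
InColors c P x = ∃[ j ] Σ (suc j < _) (λ lt → edgeCol c P j lt ≡ x)

Rainbow : ∀ {n k} → ProperColoring n → Path n k → Set
Rainbow c P = ∀ i j (li : suc i < _) (lj : suc j < _) →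
  edgeCol c P i li ≡ edgeCol c P j lj → i ≡ j

OnPath : ∀ {n k} → Path n k → Fin n → Set
OnPath {k = k} P v = ∃[ i ] Σ (i < k) (λ lt → at P i lt ≡ v)

MaxRainbow : ∀ {n k} → ProperColoring n → Path n k → Set
MaxRainbow {n} {k} c P = Rainbow c P × (∀ m (Q : Path n m) → Rainbow c Q → m ≤ k)

ΓNew : ∀ {n k} → ProperColoring n → Path n k → Fin n → Fin n → Set
ΓNew c P v u = (u ≢ v) × ¬ InColors c P (col c u v)

-- x ∈ c(v, V(P)^c): some vertex s off the path with c(v,s) = x
-- (s ≠ v is automatic when v is on the path, as for p_1 and p_k below)
InColsToOutside : ∀ {n k} → ProperColoring n → Path n k → Fin n → ℕ → Set
InColsToOutside c P v x = ∃[ s ] (¬ OnPath P s) × (col c v s ≡ x)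

-- Suppose p_i ∈ B(P) and some s off P had c(p_1, s) = c(p_i, p_{i-1}).  Rotating P at
-- p_k along the edge p_{i-1} p_k (whose colour is new) gives the rainbow path
-- p_1 … p_{i-1} p_k p_{k-1} … p_i: the edge p_{i-1} p_i is traded for p_{i-1} p_k,
-- so the colour c(p_i, p_{i-1}) disappears from the path.  Hence s p_1 … p_{i-1} p_k … p_i
-- is a rainbow path with one more vertex than P, contradicting maximality.  The
-- statement for A(P) is the same argument applied to the reversed path.
module Submission where

open import Defs renaming (sym to col-sym)
open import Data.Nat using (ℕ; zero; suc; pred; _+_; _∸_; _<_; _≤_; s≤s; z≤n; s≤s⁻¹; s<s⁻¹; _≤?_; _<?_)
open import Data.Nat.Properties
open import Data.Fin using (Fin; toℕ; fromℕ<)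
open import Data.Fin.Properties using (toℕ-injective; toℕ<n; toℕ-fromℕ<)
open import Data.Product using (_×_; _,_; proj₂; ∃-syntax)
open import Data.Empty using (⊥)
open import Data.Sum using (inj₁; inj₂)
open import Function using (_∘_)
open import Relation.Nullary using (¬_; yes; no; contradiction)
open import Relation.Binary using (tri<; tri≈; tri>)
open import Relation.Binary.PropositionalEquality

distinct⇒injective : ∀ {A : Set} {N : ℕ} (f : ℕ → A) →
  (∀ {a b} → a < b → b < N → f a ≢ f b) →
  ∀ {a b} → a < N → b < N → f a ≡ f b → a ≡ b
distinct⇒injective f distinct {a} {b} a<N b<N fa≡fb with <-cmp a b
... | tri< a<b _ _ = contradiction fa≡fb (distinct a<b b<N)
... | tri≈ _ a≡b _ = a≡b
... | tri> _ _ b<a = contradiction (sym fa≡fb) (distinct b<a a<N)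

module _ {A : Set} where

  _◃_ : A → (ℕ → A) → ℕ → A
  (s ◃ p) zero    = s
  (s ◃ p) (suc a) = p a

  reverse : ℕ → (ℕ → A) → ℕ → A
  reverse L p a = p (L ∸ a)

-- Position a of the path p_0 … p_j p_L p_{L-1} … p_{j+1}.
rotateIndex : ℕ → ℕ → ℕ → ℕ
rotateIndex j L a with a ≤? j
... | yes _ = a
... | no  _ = suc (L + j) ∸ a

rotate : ∀ {A : Set} → ℕ → ℕ → (ℕ → A) → ℕ → A
rotate j L p = p ∘ rotateIndex j L

module RotateIndex {j L : ℕ} where

  σ : ℕ → ℕ
  σ = rotateIndex j L

  σ-head : ∀ {a} → a ≤ j → σ a ≡ a
  σ-head {a} a≤j with a ≤? j
  ... | yes _   = refl
  ... | no  a≰j = contradiction a≤j a≰j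

  σ-tail : ∀ {a} → j < a → σ a ≡ suc (L + j) ∸ a
  σ-tail {a} j<a with a ≤? j
  ... | yes a≤j = contradiction a≤j (<⇒≱ j<a)
  ... | no  _   = refl

  σ-suc-j : σ (suc j) ≡ L
  σ-suc-j = trans (σ-tail ≤-refl) (m+n∸n≡m L j)

  σ-bounded : ∀ {a} → a < suc L → σ a < suc L
  σ-bounded {a} a<1+L with ≤-<-connex a j
  ... | inj₁ a≤j = subst (_< suc L) (sym (σ-head a≤j)) a<1+L
  ... | inj₂ j<a = s≤s (begin
    σ a                 ≡⟨ σ-tail j<a ⟩
    suc (L + j) ∸ a     ≤⟨ ∸-monoʳ-≤ (suc (L + j)) j<a ⟩
    L + j ∸ j           ≡⟨ m+n∸n≡m L j ⟩
    L                   ∎)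
    where open ≤-Reasoning

  σ-tail-above : ∀ {a} → j < a → a < suc L → j < σ a
  σ-tail-above {a} j<a a<1+L = begin-strict
    j                   <⟨ n<1+n j ⟩
    suc j               ≡⟨ sym (cong suc (m+n∸m≡n L j)) ⟩
    suc (L + j ∸ L)     ≡⟨ sym (+-∸-assoc 1 (m≤m+n L j)) ⟩
    suc (L + j) ∸ L     ≤⟨ ∸-monoʳ-≤ (suc (L + j)) (≤-pred a<1+L) ⟩
    suc (L + j) ∸ a     ≡⟨ sym (σ-tail j<a) ⟩
    σ a                 ∎
    where open ≤-Reasoning

  σ-tail-step : ∀ {a} → j < a → a < L → σ a ≡ suc (σ (suc a))
  σ-tail-step {a} j<a a<L = begin
    σ a                 ≡⟨ σ-tail j<a ⟩
    suc (L + j) ∸ a     ≡⟨ +-∸-assoc 1 (≤-trans (<⇒≤ a<L) (m≤m+n L j)) ⟩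
    suc (L + j ∸ a)     ≡⟨ cong suc (sym (σ-tail (m<n⇒m<1+n j<a))) ⟩
    suc (σ (suc a))     ∎
    where open ≡-Reasoning

  σ-tail-edge-bounded : ∀ {a} → j < a → a < L → σ (suc a) < L
  σ-tail-edge-bounded j<a a<L =
    s≤s⁻¹ (subst (_< suc L) (σ-tail-step j<a a<L) (σ-bounded (m<n⇒m<1+n a<L)))

  σ-injective : ∀ {a b} → a < suc L → b < suc L → σ a ≡ σ b → a ≡ b
  σ-injective = distinct⇒injective σ distinct
    where
    distinct : ∀ {a b} → a < b → b < suc L → σ a ≢ σ b
    distinct {a} {b} a<b b<1+L σa≡σb with ≤-<-connex b j | ≤-<-connex a j
    ... | inj₁ b≤j | _        = <⇒≢ a<b (trans (sym (σ-head (≤-trans (<⇒≤ a<b) b≤j)))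
                                          (trans σa≡σb (σ-head b≤j)))
    ... | inj₂ j<b | inj₁ a≤j = <⇒≢ (≤-<-trans a≤j (σ-tail-above j<b b<1+L))
                                    (trans (sym (σ-head a≤j)) σa≡σb)
    ... | inj₂ j<b | inj₂ j<a = <⇒≢ a<b (∸-cancelˡ-≡ (≤-trans (<⇒≤ a<b) b≤L+j) b≤L+j
                                    (trans (sym (σ-tail j<a)) (trans σa≡σb (σ-tail j<b))))
      where
      b≤L+j : b ≤ suc (L + j)
      b≤L+j = ≤-trans (≤-pred b<1+L) (≤-trans (m≤m+n L j) (n≤1+n (L + j)))

module RainbowSequences {n : ℕ} (c : ProperColoring n) where

  edge : (ℕ → Fin n) → ℕ → ℕ
  edge p a = col c (p a) (p (suc a))

  -- L is the index of the last vertex: the path p 0 … p L has suc L vertices.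
  record IsRainbowPath (p : ℕ → Fin n) (L : ℕ) : Set where
    field
      injective : ∀ {a b} → a < suc L → b < suc L → p a ≡ p b → a ≡ b
      rainbow   : ∀ {a b} → a < L → b < L → edge p a ≡ edge p b → a ≡ b

  HasColour : (ℕ → Fin n) → ℕ → ℕ → Set
  HasColour p L x = ∃[ a ] a < L × edge p a ≡ x

  Visits : (ℕ → Fin n) → ℕ → Fin n → Set
  Visits p L v = ∃[ a ] a < suc L × p a ≡ v

  ◃-isRainbowPath : ∀ {p L s} → IsRainbowPath p L → ¬ Visits p L s →
                    ¬ HasColour p L (col c s (p 0)) → IsRainbowPath (s ◃ p) (suc L)
  ◃-isRainbowPath {p} {L} {s} pRainbow s∉p fresh = record
    { injective = distinct⇒injective (s ◃ p) distinctVertices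
    ; rainbow   = distinct⇒injective (edge (s ◃ p)) distinctColours
    }
    where
    open IsRainbowPath pRainbow
    distinctVertices : ∀ {a b} → a < b → b < suc (suc L) → (s ◃ p) a ≢ (s ◃ p) b
    distinctVertices {zero}  {suc b} _   b<2+L s≡pb   = s∉p (b , s≤s⁻¹ b<2+L , sym s≡pb)
    distinctVertices {suc a} {suc b} a<b b<2+L pa≡pb =
      <⇒≢ a<b (cong suc (injective (<-trans (s≤s⁻¹ a<b) (s≤s⁻¹ b<2+L)) (s≤s⁻¹ b<2+L) pa≡pb))
    distinctColours : ∀ {a b} → a < b → b < suc L → edge (s ◃ p) a ≢ edge (s ◃ p) b
    distinctColours {zero}  {suc b} _   b<1+L e = fresh (b , s≤s⁻¹ b<1+L , sym e)
    distinctColours {suc a} {suc b} a<b b<1+L e =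
      <⇒≢ a<b (cong suc (rainbow (<-trans (s≤s⁻¹ a<b) (s≤s⁻¹ b<1+L)) (s≤s⁻¹ b<1+L) e))

  reverse-edge : ∀ p {L a} → a < L → edge (reverse L p) a ≡ edge p (L ∸ suc a)
  reverse-edge p {L} {a} a<L = begin
    col c (p (L ∸ a)) (p (L ∸ suc a))           ≡⟨ cong (λ k → col c (p k) (p (L ∸ suc a))) (+-∸-assoc 1 a<L) ⟩
    col c (p (suc (L ∸ suc a))) (p (L ∸ suc a)) ≡⟨ col-sym c _ _ ⟩
    edge p (L ∸ suc a)                          ∎
    where open ≡-Reasoning

  reverse-isRainbowPath : ∀ {p L} → IsRainbowPath p L → IsRainbowPath (reverse L p) L
  reverse-isRainbowPath {p} {L} pRainbow = record
    { injective = λ {a} {b} a<1+L b<1+L e →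
        ∸-cancelˡ-≡ (≤-pred a<1+L) (≤-pred b<1+L) (injective (s≤s (m∸n≤m L a)) (s≤s (m∸n≤m L b)) e)
    ; rainbow   = λ {a} {b} a<L b<L e → suc-injective (∸-cancelˡ-≡ a<L b<L
        (rainbow (∸-monoʳ-< (s≤s z≤n) a<L) (∸-monoʳ-< (s≤s z≤n) b<L)
          (trans (sym (reverse-edge p a<L)) (trans e (reverse-edge p b<L)))))
    }
    where open IsRainbowPath pRainbow

  reverse-hasColour : ∀ {p L x} → HasColour (reverse L p) L x → HasColour p L x
  reverse-hasColour {p} {L} (a , a<L , e) =
    L ∸ suc a , ∸-monoʳ-< (s≤s z≤n) a<L , trans (sym (reverse-edge p a<L)) e

  reverse-visits : ∀ {p L v} → Visits (reverse L p) L v → Visits p L v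
  reverse-visits {L = L} (a , _ , e) = L ∸ a , s≤s (m∸n≤m L a) , e

  module _ {p : ℕ → Fin n} {j L : ℕ} where
    open RotateIndex {j} {L}

    rotate-edge-head : ∀ {a} → a < j → edge (rotate j L p) a ≡ edge p a
    rotate-edge-head a<j = cong₂ (λ u v → col c (p u) (p v)) (σ-head (<⇒≤ a<j)) (σ-head a<j)

    rotate-edge-pivot : edge (rotate j L p) j ≡ col c (p j) (p L)
    rotate-edge-pivot = cong₂ (λ u v → col c (p u) (p v)) (σ-head ≤-refl) σ-suc-j

    rotate-edge-tail : ∀ {a} → j < a → a < L → edge (rotate j L p) a ≡ edge p (σ (suc a))
    rotate-edge-tail j<a a<L =
      trans (cong (λ u → col c (p u) (p (σ (suc _)))) (σ-tail-step j<a a<L)) (col-sym c _ _)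

    rotate-visits : ∀ {v} → Visits (rotate j L p) L v → Visits p L v
    rotate-visits (a , a<1+L , e) = σ a , σ-bounded a<1+L , e

    module _ (pRainbow : IsRainbowPath p L) (j<L : j < L)
             (fresh : ¬ HasColour p L (col c (p j) (p L))) where
      open IsRainbowPath pRainbow

      rotate-isRainbowPath : IsRainbowPath (rotate j L p) L
      rotate-isRainbowPath = record
        { injective = λ a<1+L b<1+L e →
            σ-injective a<1+L b<1+L (injective (σ-bounded a<1+L) (σ-bounded b<1+L) e)
        ; rainbow   = distinct⇒injective (edge (rotate j L p)) distinct
        }
        where
        distinct : ∀ {a b} → a < b → b < L → edge (rotate j L p) a ≢ edge (rotate j L p) b
        distinct {a} {b} a<b b<L e with <-cmp b j
        ... | tri< b<j _ _ = <⇒≢ a<b (rainbow (<-trans a<b b<L) b<L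
                               (trans (sym (rotate-edge-head (<-trans a<b b<j))) (trans e (rotate-edge-head b<j))))
        ... | tri≈ _ refl _ = fresh (a , <-trans a<b b<L ,
                                trans (sym (rotate-edge-head a<b)) (trans e rotate-edge-pivot))
        ... | tri> _ _ j<b with <-cmp a j
        ...   | tri< a<j _ _ = <⇒≢ (<-trans a<j (σ-tail-above (m<n⇒m<1+n j<b) (s≤s b<L)))
                                 (rainbow (<-trans a<b b<L) (σ-tail-edge-bounded j<b b<L)
                                   (trans (sym (rotate-edge-head a<j)) (trans e (rotate-edge-tail j<b b<L))))
        ...   | tri≈ _ refl _ = fresh (σ (suc b) , σ-tail-edge-bounded j<b b<L ,
                                  trans (sym (rotate-edge-tail j<b b<L)) (trans (sym e) rotate-edge-pivot))
        ...   | tri> _ _ j<a = <⇒≢ a<b (suc-injective (σ-injective (s≤s (<-trans a<b b<L)) (s≤s b<L)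
                                 (rainbow (σ-tail-edge-bounded j<a (<-trans a<b b<L)) (σ-tail-edge-bounded j<b b<L)
                                   (trans (sym (rotate-edge-tail j<a (<-trans a<b b<L)))
                                     (trans e (rotate-edge-tail j<b b<L))))))

      rotate-lacks-colour : ¬ HasColour (rotate j L p) L (edge p j)
      rotate-lacks-colour (a , a<L , e) with <-cmp a j
      ... | tri< a<j _ _ = <⇒≢ a<j (rainbow a<L j<L (trans (sym (rotate-edge-head a<j)) e))
      ... | tri≈ _ refl _ = fresh (j , j<L , trans (sym e) rotate-edge-pivot)
      ... | tri> _ _ j<a = >⇒≢ (σ-tail-above (m<n⇒m<1+n j<a) (s≤s a<L))
                             (rainbow (σ-tail-edge-bounded j<a a<L) j<L (trans (sym (rotate-edge-tail j<a a<L)) e))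

  rotate-◃-isRainbowPath : ∀ {p j L s} → IsRainbowPath p L → j < L →
    ¬ HasColour p L (col c (p j) (p L)) → ¬ Visits p L s → col c (p 0) s ≡ edge p j →
    IsRainbowPath (s ◃ rotate j L p) (suc L)
  rotate-◃-isRainbowPath {p} {j} {L} {s} pRainbow j<L fresh s∉p colour =
    ◃-isRainbowPath (rotate-isRainbowPath pRainbow j<L fresh) (s∉p ∘ rotate-visits)
      (rotate-lacks-colour pRainbow j<L fresh ∘ subst (HasColour (rotate j L p) L) bridgeColour)
    where
    open ≡-Reasoning
    bridgeColour : col c s (rotate j L p 0) ≡ edge p j
    bridgeColour = begin
      col c s (p (rotateIndex j L 0)) ≡⟨ cong (col c s ∘ p) (RotateIndex.σ-head {j} {L} z≤n) ⟩
      col c s (p 0)                   ≡⟨ col-sym c s (p 0) ⟩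
      col c (p 0) s                   ≡⟨ colour ⟩
      edge p j                        ∎

  reverse-rotate-◃-isRainbowPath : ∀ {p i L s} → IsRainbowPath p L → i < L →
    ¬ HasColour p L (col c (p (suc i)) (p 0)) → ¬ Visits p L s → col c (p L) s ≡ edge p i →
    IsRainbowPath (s ◃ rotate (L ∸ suc i) L (reverse L p)) (suc L)
  reverse-rotate-◃-isRainbowPath {p} {i} {L} {s} pRainbow i<L fresh s∉p colour =
    rotate-◃-isRainbowPath (reverse-isRainbowPath pRainbow) (∸-monoʳ-< (s≤s z≤n) i<L)
      (fresh ∘ reverse-hasColour ∘ subst (HasColour (reverse L p) L) pivotColour)
      (s∉p ∘ reverse-visits) (trans colour (sym removedColour))
    where
    open ≡-Reasoning
    pivotColour : col c (p (L ∸ (L ∸ suc i))) (p (L ∸ L)) ≡ col c (p (suc i)) (p 0)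
    pivotColour = cong₂ (λ u v → col c (p u) (p v)) (m∸[m∸n]≡n i<L) (n∸n≡0 L)
    removedColour : edge (reverse L p) (L ∸ suc i) ≡ edge p i
    removedColour = begin
      edge (reverse L p) (L ∸ suc i)    ≡⟨ reverse-edge p (∸-monoʳ-< (s≤s z≤n) i<L) ⟩
      edge p (L ∸ suc (L ∸ suc i))      ≡⟨ cong (edge p) (sym (pred[m∸n]≡m∸[1+n] L (L ∸ suc i))) ⟩
      edge p (pred (L ∸ (L ∸ suc i)))   ≡⟨ cong (edge p ∘ pred) (m∸[m∸n]≡n i<L) ⟩
      edge p i                          ∎

module _ {n : ℕ} (c : ProperColoring n) where
  open RainbowSequences c

  sequencePath : ∀ {q L} → IsRainbowPath q L → Path n (suc L)
  sequencePath {q} qRainbow = q ∘ toℕ , λ e →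
    toℕ-injective (IsRainbowPath.injective qRainbow (toℕ<n _) (toℕ<n _) e)

  sequencePath-rainbow : ∀ {q L} (qRainbow : IsRainbowPath q L) → Rainbow c (sequencePath qRainbow)
  sequencePath-rainbow {q} qRainbow a b a<L b<L e =
    IsRainbowPath.rainbow qRainbow (s<s⁻¹ a<L) (s<s⁻¹ b<L)
      (trans (edge-agrees a<L) (trans e (sym (edge-agrees b<L))))
    where
    edge-agrees : ∀ {a} (lt : suc a < _) → edge q a ≡ edgeCol c (sequencePath qRainbow) a lt
    edge-agrees {a} lt =
      cong₂ (λ u v → col c (q u) (q v)) (sym (toℕ-fromℕ< (<-trans (n<1+n a) lt))) (sym (toℕ-fromℕ< lt))

  module _ {m : ℕ} (P : Path n (suc m)) where

    -- Positions beyond m are padded with p_0.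
    vertexSeq : ℕ → Fin n
    vertexSeq a with a <? suc m
    ... | yes a<1+m = at P a a<1+m
    ... | no  _     = at P 0 (s≤s z≤n)

    vertexSeq-at : ∀ {a} (a<1+m : a < suc m) → vertexSeq a ≡ at P a a<1+m
    vertexSeq-at {a} a<1+m with a <? suc m
    ... | yes lt  = cong (at P a) (≤-irrelevant lt a<1+m)
    ... | no  a≮ = contradiction a<1+m a≮

    edge-vertexSeq : ∀ {a} (lt : suc a < suc m) → edge vertexSeq a ≡ edgeCol c P a lt
    edge-vertexSeq {a} lt = cong₂ (col c) (vertexSeq-at (<-trans (n<1+n a) lt)) (vertexSeq-at lt)

    vertexSeq-isRainbowPath : Rainbow c P → IsRainbowPath vertexSeq m
    vertexSeq-isRainbowPath rainbowP = record
      { injective = λ {a} {b} a<1+m b<1+m e → begin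
          a                    ≡⟨ sym (toℕ-fromℕ< a<1+m) ⟩
          toℕ (fromℕ< a<1+m)  ≡⟨ cong toℕ (proj₂ P (trans (sym (vertexSeq-at a<1+m))
                                                      (trans e (vertexSeq-at b<1+m)))) ⟩
          toℕ (fromℕ< b<1+m)  ≡⟨ toℕ-fromℕ< b<1+m ⟩
          b                    ∎
      ; rainbow   = λ a<m b<m e → rainbowP _ _ (s≤s a<m) (s≤s b<m)
          (trans (sym (edge-vertexSeq (s≤s a<m))) (trans e (edge-vertexSeq (s≤s b<m))))
      }
      where open ≡-Reasoning

    vertexSeq-lacks-colour : ∀ {x} → ¬ InColors c P x → ¬ HasColour vertexSeq m x
    vertexSeq-lacks-colour x∉P (a , a<m , e) = x∉P (a , s≤s a<m , trans (sym (edge-vertexSeq (s≤s a<m))) e)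

    vertexSeq-avoids : ∀ {v} → ¬ OnPath P v → ¬ Visits vertexSeq m v
    vertexSeq-avoids v∉P (a , a<1+m , e) = v∉P (a , a<1+m , trans (sym (vertexSeq-at a<1+m)) e)

    vertexSeq-lacks-edge : ∀ {a b} (a<1+m : a < suc m) (b<1+m : b < suc m) →
      ¬ InColors c P (col c (at P a a<1+m) (at P b b<1+m)) →
      ¬ HasColour vertexSeq m (col c (vertexSeq a) (vertexSeq b))
    vertexSeq-lacks-edge a<1+m b<1+m fresh = vertexSeq-lacks-colour fresh ∘
      subst (HasColour vertexSeq m) (cong₂ (col c) (vertexSeq-at a<1+m) (vertexSeq-at b<1+m))

    vertexSeq-colour : ∀ {a i s} (a<1+m : a < suc m) (lt : suc i < suc m) →
      col c (at P a a<1+m) s ≡ edgeCol c P i lt → col c (vertexSeq a) s ≡ edge vertexSeq i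
    vertexSeq-colour {s = s} a<1+m lt e =
      trans (cong (λ v → col c v s) (vertexSeq-at a<1+m)) (trans e (sym (edge-vertexSeq lt)))

proposition3 : ∀ (n m : ℕ) (c : ProperColoring n) (P : Path n (suc m)) →
    MaxRainbow c P →
    (∀ (i : ℕ) (lt : suc i < suc m) →
    ΓNew c P (at P 0 (s≤s z≤n)) (at P (suc i) lt) →
    ¬ InColsToOutside c P (at P m (n<1+n m)) (edgeCol c P i lt))
    × (∀ (i : ℕ) (lt : suc i < suc m) →
    ΓNew c P (at P m (n<1+n m)) (at P i (<-trans (n<1+n i) lt)) →
    ¬ InColsToOutside c P (at P 0 (s≤s z≤n)) (edgeCol c P i lt))
proposition3 n m c P (rainbowP , maximumP) =
  (λ i lt (_ , new) (s , s∉P , colour) → noLonger (reverse-rotate-◃-isRainbowPath pRainbow (s<s⁻¹ lt)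
    (vertexSeq-lacks-edge c P lt (s≤s z≤n) new) (vertexSeq-avoids c P s∉P)
    (vertexSeq-colour c P (n<1+n m) lt colour))) ,
  (λ i lt (_ , new) (s , s∉P , colour) → noLonger (rotate-◃-isRainbowPath pRainbow (s<s⁻¹ lt)
    (vertexSeq-lacks-edge c P (<-trans (n<1+n i) lt) (n<1+n m) new) (vertexSeq-avoids c P s∉P)
    (vertexSeq-colour c P (s≤s z≤n) lt colour)))
  where
  open RainbowSequences c
  pRainbow : IsRainbowPath (vertexSeq c P) m
  pRainbow = vertexSeq-isRainbowPath c P rainbowP
  noLonger : ∀ {q} → IsRainbowPath q (suc m) → ⊥
  noLonger qRainbow = n≮n (suc m) (maximumP _ (sequencePath c qRainbow) (sequencePath-rainbow c qRainbow))
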